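{- Let $s$ be a positive integer. For a real number $x$ define $R_0(x)=s$, $R_1(x)=x$, $R_{n+1}(x)=\frac{2x}{s}R_n(x)-R_{n-1}(x)$, and $R_0^*(x)=1$, $R_1^*(x)=\frac{2x}{s}$, $R^*_{n+1}(x)=\frac{2x}{s}R^*_n(x)-R^*_{n-1}(x)$. Let $y$ be a real number and $d=y^2-s^2$. (i) For every integer $n\geq1$, $z=R_n(y)$ and $a=R_{n-1}^*(y)$ satisfy $z^2-da^2=s^2$. (ii) Suppose $y=R_n(p)$ for some positive integers $n$ and $p$. Then for every non-negative integer $m$, $z=R_m(p)$ and $a=\frac{s}{2}\big(R_{n+m}(p)-R_{|n-m|}(p)\big)$ satisfy $a^2-dz^2=-s^2d$.
   Context: In terms of Lucas sequences, $R_n(x)=\frac{s}{2}V_n(2x/s,1)$ and $R_n^*(x)=U_{n+1}(2x/s,1)$, where $U_0=0$, $U_1=1$, $V_0=2$, $V_1=P$, and both satisfy $W_{n+1}=PW_n-QW_{n-1}$. -}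

module Defs where

open import Level using (Level; _⊔_) renaming (suc to lsuc)
open import Data.Nat using (ℕ; zero; suc; NonZero)
open import Algebra.Bundles using (CommutativeRing)
open import Relation.Nullary using (¬_)

record Field (c ℓ : Level) : Set (lsuc (c ⊔ ℓ)) where
  field
    commutativeRing : CommutativeRing c ℓ
  open CommutativeRing commutativeRing public
  field
    inv      : (x : Carrier) → ¬ (x ≈ 0#) → Carrier
    inverseʳ : (x : Carrier) (nz : ¬ (x ≈ 0#)) → x * inv x nz ≈ 1#

  ι : ℕ → Carrier
  ι zero    = 0#
  ι (suc n) = 1# + ι n

CharZero : ∀ {c ℓ} → Field c ℓ → Set ℓ
CharZero F = (n : ℕ) → ¬ (ι (suc n) ≈ 0#)
  where open Field F

module Lucas {c ℓ} (F : Field c ℓ) (ch0 : CharZero F) where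
  open Field F

  ι-nz : (s : ℕ) → {{NonZero s}} → ¬ (ι s ≈ 0#)
  ι-nz (suc k) = ch0 k

  invS : (s : ℕ) → {{NonZero s}} → Carrier
  invS s = inv (ι s) (ι-nz s)

  half : Carrier
  half = inv (ι 2) (ch0 1)

  coef : (s : ℕ) → {{NonZero s}} → Carrier → Carrier
  coef s x = (ι 2 * x) * invS s

  R : (s : ℕ) → {{NonZero s}} → ℕ → Carrier → Carrier
  R s zero          x = ι s
  R s (suc zero)    x = x
  R s (suc (suc n)) x = coef s x * R s (suc n) x - R s n x

  R* : (s : ℕ) → {{NonZero s}} → ℕ → Carrier → Carrier
  R* s zero          x = 1#
  R* s (suc zero)    x = coef s x
  R* s (suc (suc n)) x = coef s x * R* s (suc n) x - R* s n x

  sq : Carrier → Carrier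
  sq u = u * u

-- Write c = 2x/s and let Uₙ be the Lucas sequence U₀ = 0, U₁ = 1, Uₙ₊₂ = c Uₙ₊₁ − Uₙ, so that
-- R*ₙ = Uₙ₊₁ and, comparing recurrences, Rₙ₊₁ = x Uₙ₊₁ − s Uₙ.  The quadratic form
-- u² − c u v + v² is invariant along the recurrence, which together with c s = 2x gives
-- Rₙ² − d Uₙ² = s² for all n: this is (i).  For (ii), the steps s (Rₖ₊₂ − Rₖ) = 2 d Uₖ₊₁
-- telescope, and the constancy of the Casoratian Uₘ₊₁ Uₘ₊ₖ₊₁ − Uₘ Uₘ₊ₖ₊₂ = Uₖ₊₁ collects them
-- into s (Rₙ₊ₘ − R|ₙ₋ₘ|) = 2 d Uₙ Uₘ.  At x = p this says a = dₚ Uₙ Uₘ with dₚ = p² − s², while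
-- (i) gives d = dₚ Uₙ², so a² − d z² = −dₚ Uₙ² (z² − dₚ Uₘ²) = −s² d.

module Submission where

open import Defs
open import Data.Nat using (ℕ; zero; suc; NonZero; _≤_; _∸_; ∣_-_∣) renaming (_+_ to _+ℕ_; _*_ to _*ℕ_)
import Data.Nat as ℕ
open import Data.Nat.Properties using (≤-total; +-suc; m≤n⇒∃[o]m+o≡n; ∣m-m+n∣≡n; ∣-∣-comm) renaming (+-comm to +ℕ-comm)
open import Data.Nat.Tactic.RingSolver using (solve-∀)
open import Data.Product using (_×_; _,_; proj₁)
open import Data.Sum using (inj₁; inj₂)
open import Data.Maybe using (Maybe; nothing; just)
open import Function using (_∘_)
open import Relation.Nullary using (yes)
open import Relation.Binary.PropositionalEquality as ≡ using (_≡_)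
open import Algebra.Bundles using (RawRing; CommutativeRing)
import Algebra.Properties.Ring as RingProperties
import Algebra.Properties.Semiring.Mult.TCOptimised as SemiringMultiplication
import Algebra.Solver.Ring.NaturalCoefficients.Default as NaturalCoefficientSolver
open import Algebra.Solver.Ring.AlmostCommutativeRing using (_-Raw-AlmostCommutative⟶_; fromCommutativeRing)

-- Integer coefficients for the ring solver over an arbitrary commutative ring, as formal
-- differences: (a , b) stands for a − b.  Normalisation makes the representation canonical,
-- which the solver needs to close goals by refl.
normalise : ℕ × ℕ → ℕ × ℕ
normalise (suc a , suc b) = normalise (a , b)
normalise p               = p

ℤ-rawRing : RawRing _ _
ℤ-rawRing = record
  { Carrier = ℕ × ℕ
  ; _≈_     = _≡_
  ; _+_     = λ { (a , b) (c , d) → normalise (a +ℕ c , b +ℕ d) }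
  ; _*_     = λ { (a , b) (c , d) → normalise (a *ℕ c +ℕ b *ℕ d , a *ℕ d +ℕ b *ℕ c) }
  ; -_      = λ { (a , b) → (b , a) }
  ; 0#      = (0 , 0)
  ; 1#      = (1 , 0)
  }

module IntegerCoefficients {c ℓ} (R : CommutativeRing c ℓ) where
  open CommutativeRing R
  open RingProperties ring using (-‿+-comm; -‿distribˡ-*; -‿distribʳ-*; -‿involutive; -0#≈0#; ⁻¹-anti-homo‿-)
  open SemiringMultiplication semiring using (×-homo-+; ×1-homo-*; 1+×) renaming (_×_ to _·_)
  open NaturalCoefficientSolver commutativeSemiring using (_:+_; _:*_; _:=_) renaming (solve to solveℕ)
  open import Relation.Binary.Reasoning.Setoid setoid
  private module ℤ = RawRing ℤ-rawRing

  sub-+-interchange : ∀ a b c d → (a + c) - (b + d) ≈ (a - b) + (c - d)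
  sub-+-interchange a b c d = begin
    (a + c) - (b + d)       ≈⟨ +-congˡ (-‿+-comm b d) ⟨
    (a + c) + (- b + - d)   ≈⟨ solveℕ 4 (λ a c b d → (a :+ c) :+ (b :+ d) := (a :+ b) :+ (c :+ d)) refl a c (- b) (- d) ⟩
    (a - b) + (c - d)       ∎

  sub-cancelˡ : ∀ a b c → (a + b) - (a + c) ≈ b - c
  sub-cancelˡ a b c = begin
    (a + b) - (a + c)   ≈⟨ sub-+-interchange a a b c ⟩
    (a - a) + (b - c)   ≈⟨ +-congʳ (-‿inverseʳ a) ⟩
    0# + (b - c)        ≈⟨ +-identityˡ (b - c) ⟩
    b - c               ∎

  sub-*-expand : ∀ a b c d → (a * c + b * d) - (a * d + b * c) ≈ (a - b) * (c - d)
  sub-*-expand a b c d = begin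
    (a * c + b * d) - (a * d + b * c)          ≈⟨ +-congˡ (-‿+-comm (a * d) (b * c)) ⟨
    (a * c + b * d) + (- (a * d) + - (b * c))  ≈⟨ +-cong (+-congˡ bd≈-b*-d) (+-cong (-‿distribʳ-* a d) (-‿distribˡ-* b c)) ⟩
    (a * c + - b * - d) + (a * - d + - b * c)  ≈⟨ solveℕ 4 (λ a b c d → (a :* c :+ b :* d) :+ (a :* d :+ b :* c) := (a :+ b) :* (c :+ d)) refl a (- b) c (- d) ⟩
    (a - b) * (c - d)                          ∎
    where
    bd≈-b*-d : b * d ≈ - b * - d
    bd≈-b*-d = begin
      b * d         ≈⟨ *-congʳ (-‿involutive b) ⟨
      - - b * d     ≈⟨ -‿distribˡ-* (- b) d ⟨
      - (- b * d)   ≈⟨ -‿distribʳ-* (- b) d ⟩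
      - b * - d     ∎

  difference : ℕ × ℕ → Carrier
  difference (a , b) = a · 1# - b · 1#

  difference-normalise : ∀ p → difference (normalise p) ≈ difference p
  difference-normalise (zero  , b)     = refl
  difference-normalise (suc a , zero)  = refl
  difference-normalise (suc a , suc b) = begin
    difference (normalise (a , b))         ≈⟨ difference-normalise (a , b) ⟩
    a · 1# - b · 1#                        ≈⟨ sub-cancelˡ 1# (a · 1#) (b · 1#) ⟨
    (1# + a · 1#) - (1# + b · 1#)          ≈⟨ +-cong (1+× a 1#) (-‿cong (1+× b 1#)) ⟨
    suc a · 1# - suc b · 1#                ∎

  ·1-homo-*+* : ∀ a b c d → (a *ℕ b +ℕ c *ℕ d) · 1# ≈ (a · 1#) * (b · 1#) + (c · 1#) * (d · 1#)
  ·1-homo-*+* a b c d = trans (×-homo-+ 1# (a *ℕ b) (c *ℕ d)) (+-cong (×1-homo-* a b) (×1-homo-* c d))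

  difference-+ : ∀ p q → difference (p ℤ.+ q) ≈ difference p + difference q
  difference-+ (a , b) (c , d) = begin
    difference (normalise (a +ℕ c , b +ℕ d))    ≈⟨ difference-normalise (a +ℕ c , b +ℕ d) ⟩
    (a +ℕ c) · 1# - (b +ℕ d) · 1#              ≈⟨ +-cong (×-homo-+ 1# a c) (-‿cong (×-homo-+ 1# b d)) ⟩
    (a · 1# + c · 1#) - (b · 1# + d · 1#)      ≈⟨ sub-+-interchange _ _ _ _ ⟩
    difference (a , b) + difference (c , d)    ∎

  difference-* : ∀ p q → difference (p ℤ.* q) ≈ difference p * difference q
  difference-* (a , b) (c , d) = begin
    difference (normalise (a *ℕ c +ℕ b *ℕ d , a *ℕ d +ℕ b *ℕ c))   ≈⟨ difference-normalise (a *ℕ c +ℕ b *ℕ d , a *ℕ d +ℕ b *ℕ c) ⟩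
    (a *ℕ c +ℕ b *ℕ d) · 1# - (a *ℕ d +ℕ b *ℕ c) · 1#             ≈⟨ +-cong (·1-homo-*+* a c b d) (-‿cong (·1-homo-*+* a d b c)) ⟩
    (A * C + B * D) - (A * D + B * C)                               ≈⟨ sub-*-expand A B C D ⟩
    difference (a , b) * difference (c , d)                         ∎
    where A = a · 1#; B = b · 1#; C = c · 1#; D = d · 1#

  -- Constants of the solver must denote 0# and 1# definitionally, or solved equations would not match goals.
  ⟦_⟧ℤ : ℕ × ℕ → Carrier
  ⟦ a , zero ⟧ℤ = a · 1#
  ⟦ p@(_ , suc _) ⟧ℤ = difference p

  ⟦⟧ℤ≈difference : ∀ p → ⟦ p ⟧ℤ ≈ difference p
  ⟦⟧ℤ≈difference (a , zero)  = sym (trans (+-congˡ -0#≈0#) (+-identityʳ (a · 1#)))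
  ⟦⟧ℤ≈difference (a , suc b) = refl

  ℤ-homomorphism : ℤ-rawRing -Raw-AlmostCommutative⟶ fromCommutativeRing R
  ℤ-homomorphism = record
    { ⟦_⟧    = ⟦_⟧ℤ
    ; +-homo = λ p q → begin
        ⟦ p ℤ.+ q ⟧ℤ                  ≈⟨ ⟦⟧ℤ≈difference (p ℤ.+ q) ⟩
        difference (p ℤ.+ q)          ≈⟨ difference-+ p q ⟩
        difference p + difference q   ≈⟨ +-cong (⟦⟧ℤ≈difference p) (⟦⟧ℤ≈difference q) ⟨
        ⟦ p ⟧ℤ + ⟦ q ⟧ℤ               ∎
    ; *-homo = λ p q → begin
        ⟦ p ℤ.* q ⟧ℤ                  ≈⟨ ⟦⟧ℤ≈difference (p ℤ.* q) ⟩
        difference (p ℤ.* q)          ≈⟨ difference-* p q ⟩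
        difference p * difference q   ≈⟨ *-cong (⟦⟧ℤ≈difference p) (⟦⟧ℤ≈difference q) ⟨
        ⟦ p ⟧ℤ * ⟦ q ⟧ℤ               ∎
    ; -‿homo = λ { p@(a , b) → begin
        ⟦ b , a ⟧ℤ           ≈⟨ ⟦⟧ℤ≈difference (b , a) ⟩
        difference (b , a)   ≈⟨ ⁻¹-anti-homo‿- (a · 1#) (b · 1#) ⟨
        - difference p       ≈⟨ -‿cong (⟦⟧ℤ≈difference p) ⟨
        - ⟦ p ⟧ℤ             ∎ }
    ; 0-homo = refl
    ; 1-homo = refl
    }

  ℤ-equal? : ∀ p q → Maybe (⟦ p ⟧ℤ ≈ ⟦ q ⟧ℤ)
  ℤ-equal? (a , b) (c , d) with a ℕ.≟ c | b ℕ.≟ d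
  ... | yes ≡.refl | yes ≡.refl = just refl
  ... | _          | _          = nothing

  open import Algebra.Solver.Ring ℤ-rawRing (fromCommutativeRing R) ℤ-homomorphism ℤ-equal? public



module Recurrence {a ℓ} (R : CommutativeRing a ℓ) (c : CommutativeRing.Carrier R) where
  open CommutativeRing R
  open IntegerCoefficients R
  open import Relation.Binary.Reasoning.Setoid setoid

  Recurrent : (ℕ → Carrier) → Set ℓ
  Recurrent f = ∀ k → f (suc (suc k)) ≈ c * f (suc k) - f k

  cassiniForm : Carrier → Carrier → Carrier
  cassiniForm u v = u * u - c * (u * v) + v * v

  module _ {f : ℕ → Carrier} (f-rec : Recurrent f) where

    recurrent-scale : ∀ u → Recurrent (λ k → u * f k)
    recurrent-scale u k = begin
      u * f (suc (suc k))          ≈⟨ *-congˡ (f-rec k) ⟩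
      u * (c * f (suc k) - f k)    ≈⟨ solve 4 (λ u c f₁ f₀ → u :* (c :* f₁ :- f₀) := c :* (u :* f₁) :- u :* f₀) refl u c (f (suc k)) (f k) ⟩
      c * (u * f (suc k)) - u * f k ∎

    cassini-invariant : ∀ k → cassiniForm (f (suc k)) (f k) ≈ cassiniForm (f 1) (f 0)
    cassini-invariant zero    = refl
    cassini-invariant (suc k) = begin
      cassiniForm (f (suc (suc k))) (f (suc k))        ≈⟨ +-congʳ (+-cong (*-cong (f-rec k) (f-rec k)) (-‿cong (*-congˡ (*-congʳ (f-rec k))))) ⟩
      cassiniForm (c * f (suc k) - f k) (f (suc k))    ≈⟨ solve 3 (λ c f₁ f₀ → (c :* f₁ :- f₀) :* (c :* f₁ :- f₀) :- c :* ((c :* f₁ :- f₀) :* f₁) :+ f₁ :* f₁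
                                                                   := f₁ :* f₁ :- c :* (f₁ :* f₀) :+ f₀ :* f₀) refl c (f (suc k)) (f k) ⟩
      cassiniForm (f (suc k)) (f k)                    ≈⟨ cassini-invariant k ⟩
      cassiniForm (f 1) (f 0)                          ∎

  module _ {f g : ℕ → Carrier} (f-rec : Recurrent f) (g-rec : Recurrent g) where

    recurrent-sub : ∀ u v → Recurrent (λ k → u * f k - v * g k)
    recurrent-sub u v k = begin
      u * f (suc (suc k)) - v * g (suc (suc k))                 ≈⟨ +-cong (*-congˡ (f-rec k)) (-‿cong (*-congˡ (g-rec k))) ⟩
      u * (c * f (suc k) - f k) - v * (c * g (suc k) - g k)    ≈⟨ solve 7 (λ u v c f₁ f₀ g₁ g₀ → u :* (c :* f₁ :- f₀) :- v :* (c :* g₁ :- g₀)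
                                                                          := c :* (u :* f₁ :- v :* g₁) :- (u :* f₀ :- v :* g₀))
                                                                    refl u v c (f (suc k)) (f k) (g (suc k)) (g k) ⟩
      c * (u * f (suc k) - v * g (suc k)) - (u * f k - v * g k) ∎

    recurrent-unique : f 0 ≈ g 0 → f 1 ≈ g 1 → ∀ k → f k ≈ g k
    recurrent-unique f₀≈g₀ f₁≈g₁ k = proj₁ (agree k)
      where
      agree : ∀ k → f k ≈ g k × f (suc k) ≈ g (suc k)
      agree zero    = f₀≈g₀ , f₁≈g₁
      agree (suc k) = let (eq₀ , eq₁) = agree k in
        eq₁ , trans (f-rec k) (trans (+-cong (*-congˡ eq₁) (-‿cong eq₀)) (sym (g-rec k)))

    casoratian-invariant : ∀ j m → f (suc m) * g (m +ℕ j) - f m * g (suc m +ℕ j) ≈ f 1 * g j - f 0 * g (suc j)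
    casoratian-invariant j zero    = refl
    casoratian-invariant j (suc m) = begin
      f (suc (suc m)) * g (suc m +ℕ j) - f (suc m) * g (suc (suc m) +ℕ j)  ≈⟨ +-cong (*-congʳ (f-rec m)) (-‿cong (*-congˡ (g-rec (m +ℕ j)))) ⟩
      (c * f (suc m) - f m) * G₁ - f (suc m) * (c * G₁ - g (m +ℕ j))      ≈⟨ solve 5 (λ c f₁ f₀ g₁ g₀ → (c :* f₁ :- f₀) :* g₁ :- f₁ :* (c :* g₁ :- g₀)
                                                                                      := f₁ :* g₀ :- f₀ :* g₁) refl c (f (suc m)) (f m) G₁ (g (m +ℕ j)) ⟩
      f (suc m) * g (m +ℕ j) - f m * G₁                                   ≈⟨ casoratian-invariant j m ⟩
      f 1 * g j - f 0 * g (suc j)                                         ∎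
      where G₁ = g (suc m +ℕ j)

module FieldArithmetic {a ℓ} (F : Field a ℓ) (ch0 : CharZero F) where
  open Field F
  open Lucas F ch0
  open import Relation.Binary.Reasoning.Setoid setoid

  ι2*≈+ : ∀ z → ι 2 * z ≈ z + z
  ι2*≈+ z = begin
    (1# + (1# + 0#)) * z   ≈⟨ *-congʳ (+-congˡ (+-identityʳ 1#)) ⟩
    (1# + 1#) * z          ≈⟨ distribʳ z 1# 1# ⟩
    1# * z + 1# * z        ≈⟨ +-cong (*-identityˡ z) (*-identityˡ z) ⟩
    z + z                  ∎

  half*[z+z]≈z : ∀ z → half * (z + z) ≈ z
  half*[z+z]≈z z = begin
    half * (z + z)      ≈⟨ *-congˡ (ι2*≈+ z) ⟨
    half * (ι 2 * z)    ≈⟨ *-assoc half (ι 2) z ⟨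
    (half * ι 2) * z    ≈⟨ *-congʳ (trans (*-comm half (ι 2)) (inverseʳ (ι 2) (ch0 1))) ⟩
    1# * z              ≈⟨ *-identityˡ z ⟩
    z                   ∎

  coef*ι≈+ : ∀ s {{_ : NonZero s}} x → coef s x * ι s ≈ x + x
  coef*ι≈+ s x = begin
    ((ι 2 * x) * invS s) * ι s   ≈⟨ *-assoc (ι 2 * x) (invS s) (ι s) ⟩
    (ι 2 * x) * (invS s * ι s)   ≈⟨ *-congˡ (trans (*-comm (invS s) (ι s)) (inverseʳ (ι s) (ι-nz s))) ⟩
    (ι 2 * x) * 1#               ≈⟨ *-identityʳ (ι 2 * x) ⟩
    ι 2 * x                      ≈⟨ ι2*≈+ x ⟩
    x + x                        ∎

module LucasIdentities {a ℓ} (F : Field a ℓ) (ch0 : CharZero F) (s : ℕ) {{_ : NonZero s}} (x : Field.Carrier F) where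
  open Field F
  open Lucas F ch0
  open FieldArithmetic F ch0 using (coef*ι≈+; half*[z+z]≈z)
  open IntegerCoefficients commutativeRing
  open Recurrence commutativeRing (coef s x)
  open import Relation.Binary.Reasoning.Setoid setoid

  d : Carrier
  d = sq x - sq (ι s)

  Rₓ : ℕ → Carrier
  Rₓ n = R s n x

  U : ℕ → Carrier
  U zero    = 0#
  U (suc n) = R* s n x

  Rₓ-cong : ∀ {m n} → m ≡ n → Rₓ m ≈ Rₓ n
  Rₓ-cong = reflexive ∘ ≡.cong Rₓ

  U-cong : ∀ {m n} → m ≡ n → U m ≈ U n
  U-cong = reflexive ∘ ≡.cong U

  R-recurrent : Recurrent Rₓ
  R-recurrent k = refl

  U-recurrent : Recurrent U
  U-recurrent zero    = solve 1 (λ c → c := c :* con (1 , 0) :- con (0 , 0)) refl (coef s x)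
  U-recurrent (suc k) = refl

  -- The only relation between c = 2x/s, x and s that the identities below need.
  coef-defect≈0 : coef s x * ι s - (x + x) ≈ 0#
  coef-defect≈0 = trans (+-congʳ (coef*ι≈+ s x)) (-‿inverseʳ (x + x))

  drop-defect : ∀ u t → u + (coef s x * ι s - (x + x)) * t ≈ u
  drop-defect u t = trans (+-congˡ (trans (*-congʳ coef-defect≈0) (zeroˡ t))) (+-identityʳ u)

  R-via-U : ∀ k → Rₓ (suc k) ≈ x * U (suc k) - ι s * U k
  R-via-U = recurrent-unique (R-recurrent ∘ suc) (recurrent-sub (U-recurrent ∘ suc) U-recurrent x (ι s))
    (solve 2 (λ x S → x := x :* con (1 , 0) :- S :* con (0 , 0)) refl x (ι s))
    (solve 3 (λ c x S → c :* x :- S := x :* c :- S :* con (1 , 0)) refl (coef s x) x (ι s))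

  U-cassini : ∀ k → cassiniForm (U (suc k)) (U k) ≈ 1#
  U-cassini k = trans (cassini-invariant U-recurrent k)
    (solve 1 (λ c → con (1 , 0) :* con (1 , 0) :- c :* (con (1 , 0) :* con (0 , 0)) :+ con (0 , 0) :* con (0 , 0) := con (1 , 0)) refl (coef s x))

  R-pell : ∀ n → sq (Rₓ n) - d * sq (U n) ≈ sq (ι s)
  R-pell zero    = solve 2 (λ S d → S :* S :- d :* (con (0 , 0) :* con (0 , 0)) := S :* S) refl (ι s) d
  R-pell (suc k) = begin
    sq (Rₓ (suc k)) - d * sq u                                  ≈⟨ +-congʳ (*-cong (R-via-U k) (R-via-U k)) ⟩
    sq (x * u - S * v) - (sq x - sq S) * sq u                   ≈⟨ solve 5 (λ x S u v c → (x :* u :- S :* v) :* (x :* u :- S :* v) :- (x :* x :- S :* S) :* (u :* u)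
                                                                          := S :* S :* (u :* u :- c :* (u :* v) :+ v :* v) :+ (c :* S :- (x :+ x)) :* (S :* u :* v))
                                                                   refl x S u v (coef s x) ⟩
    sq S * cassiniForm u v + (coef s x * S - (x + x)) * (S * u * v)  ≈⟨ drop-defect (sq S * cassiniForm u v) (S * u * v) ⟩
    sq S * cassiniForm u v                                      ≈⟨ *-congˡ (U-cassini k) ⟩
    sq S * 1#                                                   ≈⟨ *-identityʳ (sq S) ⟩
    sq S                                                        ∎
    where S = ι s; u = U (suc k); v = U k

  R-step-difference : ∀ k → ι s * Rₓ (suc (suc k)) - ι s * Rₓ k ≈ (d + d) * U (suc k)
  R-step-difference = recurrent-unique (recurrent-sub (R-recurrent ∘ suc ∘ suc) R-recurrent (ι s) (ι s))
                                       (recurrent-scale (U-recurrent ∘ suc) (d + d))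
    (begin
      S * (c * x - S) - S * S                          ≈⟨ solve 3 (λ S c x → S :* (c :* x :- S) :- S :* S
                                                                  := (x :* x :- S :* S :+ (x :* x :- S :* S)) :* con (1 , 0) :+ (c :* S :- (x :+ x)) :* x)
                                                           refl S c x ⟩
      (d + d) * 1# + (c * S - (x + x)) * x             ≈⟨ drop-defect ((d + d) * 1#) x ⟩
      (d + d) * 1#                                     ∎)
    (begin
      S * (c * (c * x - S) - x) - S * x                ≈⟨ solve 3 (λ S c x → S :* (c :* (c :* x :- S) :- x) :- S :* x
                                                                  := (x :* x :- S :* S :+ (x :* x :- S :* S)) :* c :+ (c :* S :- (x :+ x)) :* (c :* x :+ S))
                                                           refl S c x ⟩
      (d + d) * c + (c * S - (x + x)) * (c * x + S)    ≈⟨ drop-defect ((d + d) * c) (c * x + S) ⟩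
      (d + d) * c                                      ∎)
    where S = ι s; c = coef s x

  U-product : ∀ m k → U (suc m) * U (suc m +ℕ k) - U m * U (m +ℕ suc (suc k)) ≈ U (suc k)
  U-product m k = begin
    U (suc m) * U (suc m +ℕ k) - U m * U (m +ℕ suc (suc k))    ≈⟨ +-cong (*-congˡ (U-cong (+-suc m k))) (-‿cong (*-congˡ (U-cong (≡.sym (+-suc m (suc k)))))) ⟨
    U (suc m) * U (m +ℕ suc k) - U m * U (suc m +ℕ suc k)      ≈⟨ casoratian-invariant U-recurrent U-recurrent (suc k) m ⟩
    1# * U (suc k) - 0# * U (suc (suc k))                        ≈⟨ solve 2 (λ u v → con (1 , 0) :* u :- con (0 , 0) :* v := u) refl (U (suc k)) (U (suc (suc k))) ⟩
    U (suc k)                                                    ∎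

  R-difference-product : ∀ m k → ι s * Rₓ (m +ℕ (m +ℕ k)) - ι s * Rₓ k ≈ (d + d) * (U m * U (m +ℕ k))
  R-difference-product zero    k = solve 4 (λ S r D u → S :* r :- S :* r := (D :+ D) :* (con (0 , 0) :* u)) refl (ι s) (Rₓ k) d (U k)
  R-difference-product (suc m) k = begin
    S * Rₓ (suc m +ℕ (suc m +ℕ k)) - S * Rₓ k                        ≈⟨ +-congʳ (*-congˡ (Rₓ-cong (index-shift m k))) ⟩
    S * Rₓ (m +ℕ (m +ℕ k₂)) - S * Rₓ k                               ≈⟨ solve 4 (λ S a b c → S :* a :- S :* c := (S :* a :- S :* b) :+ (S :* b :- S :* c))
                                                                          refl S (Rₓ (m +ℕ (m +ℕ k₂))) (Rₓ k₂) (Rₓ k) ⟩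
    (S * Rₓ (m +ℕ (m +ℕ k₂)) - S * Rₓ k₂) + (S * Rₓ k₂ - S * Rₓ k)  ≈⟨ +-cong (R-difference-product m k₂) (R-step-difference k) ⟩
    (d + d) * (U m * U (m +ℕ k₂)) + (d + d) * U (suc k)              ≈⟨ +-congˡ (*-congˡ (U-product m k)) ⟨
    (d + d) * (U m * U (m +ℕ k₂)) + (d + d) * (U (suc m) * U (suc m +ℕ k) - U m * U (m +ℕ k₂))
                                                                      ≈⟨ solve 5 (λ D a b p q → (D :+ D) :* (a :* b) :+ (D :+ D) :* (p :* q :- a :* b) := (D :+ D) :* (p :* q))
                                                                          refl d (U m) (U (m +ℕ k₂)) (U (suc m)) (U (suc m +ℕ k)) ⟩
    (d + d) * (U (suc m) * U (suc m +ℕ k))                           ∎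
    where
    S = ι s
    k₂ = suc (suc k)
    index-shift : ∀ m k → suc m +ℕ (suc m +ℕ k) ≡ m +ℕ (m +ℕ suc (suc k))
    index-shift = solve-∀

  R-sum-difference-≤ : ∀ {n m} → n ≤ m → ι s * Rₓ (n +ℕ m) - ι s * Rₓ ∣ n - m ∣ ≈ (d + d) * (U n * U m)
  R-sum-difference-≤ {n} n≤m with m≤n⇒∃[o]m+o≡n n≤m
  ... | k , ≡.refl = trans (+-congˡ (-‿cong (*-congˡ (Rₓ-cong (∣m-m+n∣≡n n k))))) (R-difference-product n k)

  R-sum-difference : ∀ n m → ι s * Rₓ (n +ℕ m) - ι s * Rₓ ∣ n - m ∣ ≈ (d + d) * (U n * U m)
  R-sum-difference n m with ≤-total n m
  ... | inj₁ n≤m = R-sum-difference-≤ n≤m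
  ... | inj₂ m≤n = begin
    ι s * Rₓ (n +ℕ m) - ι s * Rₓ ∣ n - m ∣   ≈⟨ +-cong (*-congˡ (Rₓ-cong (+ℕ-comm n m))) (-‿cong (*-congˡ (Rₓ-cong (∣-∣-comm n m)))) ⟩
    ι s * Rₓ (m +ℕ n) - ι s * Rₓ ∣ m - n ∣   ≈⟨ R-sum-difference-≤ m≤n ⟩
    (d + d) * (U m * U n)                    ≈⟨ *-congˡ (*-comm (U m) (U n)) ⟩
    (d + d) * (U n * U m)                    ∎

  R-sum-difference-halved : ∀ n m → (half * ι s) * (Rₓ (n +ℕ m) - Rₓ ∣ n - m ∣) ≈ d * (U n * U m)
  R-sum-difference-halved n m = begin
    (half * S) * (Rₓ (n +ℕ m) - Rₓ ∣ n - m ∣)          ≈⟨ solve 4 (λ h S a b → (h :* S) :* (a :- b) := h :* (S :* a :- S :* b)) refl half S (Rₓ (n +ℕ m)) (Rₓ ∣ n - m ∣) ⟩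
    half * (S * Rₓ (n +ℕ m) - S * Rₓ ∣ n - m ∣)        ≈⟨ *-congˡ (R-sum-difference n m) ⟩
    half * ((d + d) * (U n * U m))                      ≈⟨ *-congˡ (distribʳ (U n * U m) d d) ⟩
    half * (d * (U n * U m) + d * (U n * U m))          ≈⟨ half*[z+z]≈z (d * (U n * U m)) ⟩
    d * (U n * U m)                                     ∎
    where S = ι s

  R-discriminant : ∀ n → sq (Rₓ n) - sq (ι s) ≈ d * sq (U n)
  R-discriminant n = begin
    sq (Rₓ n) - sq (ι s)                          ≈⟨ +-congˡ (-‿cong (R-pell n)) ⟨
    sq (Rₓ n) - (sq (Rₓ n) - d * sq (U n))        ≈⟨ solve 3 (λ r d u → r :- (r :- d :* u) := d :* u) refl (sq (Rₓ n)) d (sq (U n)) ⟩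
    d * sq (U n)                                  ∎

  product-pell : ∀ n m → sq (d * (U n * U m)) - (d * sq (U n)) * sq (Rₓ m) ≈ - (sq (ι s) * (d * sq (U n)))
  product-pell n m = begin
    sq (d * (U n * U m)) - (d * sq (U n)) * sq (Rₓ m)   ≈⟨ solve 4 (λ d u v r → (d :* (u :* v)) :* (d :* (u :* v)) :- (d :* (u :* u)) :* (r :* r)
                                                                    := :- ((r :* r :- d :* (v :* v)) :* (d :* (u :* u)))) refl d (U n) (U m) (Rₓ m) ⟩
    - ((sq (Rₓ m) - d * sq (U m)) * (d * sq (U n)))    ≈⟨ -‿cong (*-congʳ (R-pell m)) ⟩
    - (sq (ι s) * (d * sq (U n)))                       ∎

mainTheorem9 : ∀ {c ℓ} (F : Field c ℓ) (ch0 : CharZero F) →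
    let open Field F
        open Lucas F ch0
    in (s : ℕ) → {{_ : NonZero s}} → (y : Carrier) →
       let d = sq y - sq (ι s) in
       ((n : ℕ) → 1 ≤ n →
          sq (R s n y) - d * sq (R* s (n ∸ 1) y) ≈ sq (ι s))
       ×
       ((n p : ℕ) → 1 ≤ n → 1 ≤ p → y ≈ R s n (ι p) → (m : ℕ) →
          sq ((half * ι s) * (R s (n +ℕ m) (ι p) - R s ∣ n - m ∣ (ι p)))
            - d * sq (R s m (ι p))
          ≈ - (sq (ι s) * d))
mainTheorem9 F ch0 s y = pell-y , pell-product
  where
  open Field F
  open Lucas F ch0
  open import Relation.Binary.Reasoning.Setoid setoid
  module Y = LucasIdentities F ch0 s y

  pell-y : (n : ℕ) → 1 ≤ n → sq (R s n y) - Y.d * sq (R* s (n ∸ 1) y) ≈ sq (ι s)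
  pell-y (suc k) _ = Y.R-pell (suc k)

  pell-product : (n p : ℕ) → 1 ≤ n → 1 ≤ p → y ≈ R s n (ι p) → (m : ℕ) →
    sq ((half * ι s) * (R s (n +ℕ m) (ι p) - R s ∣ n - m ∣ (ι p))) - Y.d * sq (R s m (ι p)) ≈ - (sq (ι s) * Y.d)
  pell-product n p _ _ y≈Rₙ m = begin
    sq ((half * ι s) * (Rₓ (n +ℕ m) - Rₓ ∣ n - m ∣)) - Y.d * sq (Rₓ m)   ≈⟨ +-cong (*-cong (R-sum-difference-halved n m) (R-sum-difference-halved n m)) (-‿cong (*-congʳ y-discriminant)) ⟩
    sq (d * (U n * U m)) - (d * sq (U n)) * sq (Rₓ m)                    ≈⟨ product-pell n m ⟩
    - (sq (ι s) * (d * sq (U n)))                                        ≈⟨ -‿cong (*-congˡ y-discriminant) ⟨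
    - (sq (ι s) * Y.d)                                                   ∎
    where
    open LucasIdentities F ch0 s (ι p)
    y-discriminant : Y.d ≈ d * sq (U n)
    y-discriminant = trans (+-congʳ (*-cong y≈Rₙ y≈Rₙ)) (R-discriminant n)
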